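{- In a target–context category $(\mathcal{C},T,C,\succeq)$, the lax context-reduction relation is a preorder on every hom-set $\mathcal{C}(A,T)$.
   Context: A gs-monoidal category is a symmetric monoidal category (tensor $\otimes$, unit $I$, unitors suppressed) whose objects carry commutative comonoids $\mathrm{copy}_A\colon A\to A\otimes A$, $\mathrm{del}_A\colon A\to I$ compatible with $\otimes$, with $\mathrm{del}_I=\mathrm{id}_I$. For $f\colon A\to X$: $\mathrm{dom}(f)=(\mathrm{id}_A\otimes(\mathrm{del}_X\circ f))\circ\mathrm{copy}_A$; normalized: $f\circ\mathrm{dom}(f)=f$. A target–context category $(\mathcal{C},T,C,\succeq)$ is a gs-monoidal category with all morphisms normalized, objects $T,C$ and a preorder $\succeq$ on each $\mathcal{C}(A,T\otimes C)$ such that $f\circ\mathrm{dom}(g)=g\Rightarrow f\succeq g$ and $f\succeq g\Rightarrow f\circ h\succeq g\circ h$ for all $f,g\colon A\to T\otimes C$, $h\colon Z\to A$. For $f,g\colon A\to T$, $f$ lax context-reduces to $g$ if there exists a morphism $f_C\colon A\otimes C\to C$ with $(f\otimes f_C)\circ(\mathrm{copy}_A\otimes\mathrm{id}_C)\succeq g\otimes\mathrm{id}_C$. -}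

module Defs where

-- Associators, unitors and the symmetry are explicit isomorphisms
-- satisfying the standard coherence axioms; the paper "suppresses"
-- the unitors only notationally.

open import Level using (Level; _⊔_; suc)
open import Relation.Binary using (Rel; IsEquivalence; IsPreorder)
open import Data.Product using (Σ; _,_)

record GsMonoidal (o ℓ e : Level) : Set (suc (o ⊔ ℓ ⊔ e)) where
  infixr 9 _∘_
  infixr 10 _⊗₀_ _⊗₁_
  infix  4 _≈_
  field
    Obj  : Set o
    _⇒_  : Obj → Obj → Set ℓ
    _≈_  : ∀ {A B} → Rel (A ⇒ B) e
    id   : ∀ {A} → A ⇒ A
    _∘_  : ∀ {A B C} → B ⇒ C → A ⇒ B → A ⇒ C
    ≈-equiv   : ∀ {A B} → IsEquivalence (_≈_ {A} {B})
    ∘-resp-≈  : ∀ {A B C} {f h : B ⇒ C} {g i : A ⇒ B} →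
                f ≈ h → g ≈ i → f ∘ g ≈ h ∘ i
    identityˡ : ∀ {A B} {f : A ⇒ B} → id ∘ f ≈ f
    identityʳ : ∀ {A B} {f : A ⇒ B} → f ∘ id ≈ f
    assoc     : ∀ {A B C D} {f : A ⇒ B} {g : B ⇒ C} {h : C ⇒ D} →
                (h ∘ g) ∘ f ≈ h ∘ (g ∘ f)

    _⊗₀_ : Obj → Obj → Obj
    _⊗₁_ : ∀ {A B C D} → A ⇒ B → C ⇒ D → (A ⊗₀ C) ⇒ (B ⊗₀ D)
    I    : Obj
    ⊗-resp-≈ : ∀ {A B C D} {f g : A ⇒ B} {h i : C ⇒ D} →
               f ≈ g → h ≈ i → f ⊗₁ h ≈ g ⊗₁ i
    ⊗-id     : ∀ {A B} → id {A} ⊗₁ id {B} ≈ id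
    ⊗-∘      : ∀ {A B C D E F} {f : B ⇒ C} {g : A ⇒ B} {h : E ⇒ F} {k : D ⇒ E} →
               (f ∘ g) ⊗₁ (h ∘ k) ≈ (f ⊗₁ h) ∘ (g ⊗₁ k)

    λ⇒ : ∀ {A} → (I ⊗₀ A) ⇒ A
    λ⇐ : ∀ {A} → A ⇒ (I ⊗₀ A)
    ρ⇒ : ∀ {A} → (A ⊗₀ I) ⇒ A
    ρ⇐ : ∀ {A} → A ⇒ (A ⊗₀ I)
    α⇒ : ∀ {A B C} → ((A ⊗₀ B) ⊗₀ C) ⇒ (A ⊗₀ (B ⊗₀ C))
    α⇐ : ∀ {A B C} → (A ⊗₀ (B ⊗₀ C)) ⇒ ((A ⊗₀ B) ⊗₀ C)
    σ  : ∀ {A B} → (A ⊗₀ B) ⇒ (B ⊗₀ A)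

    λ-isoˡ : ∀ {A} → λ⇐ {A} ∘ λ⇒ ≈ id
    λ-isoʳ : ∀ {A} → λ⇒ {A} ∘ λ⇐ ≈ id
    ρ-isoˡ : ∀ {A} → ρ⇐ {A} ∘ ρ⇒ ≈ id
    ρ-isoʳ : ∀ {A} → ρ⇒ {A} ∘ ρ⇐ ≈ id
    α-isoˡ : ∀ {A B C} → α⇐ {A} {B} {C} ∘ α⇒ ≈ id
    α-isoʳ : ∀ {A B C} → α⇒ {A} {B} {C} ∘ α⇐ ≈ id
    σ-inv  : ∀ {A B} → σ {B} {A} ∘ σ {A} {B} ≈ id

    λ-natural : ∀ {A B} {f : A ⇒ B} → f ∘ λ⇒ ≈ λ⇒ ∘ (id ⊗₁ f)
    ρ-natural : ∀ {A B} {f : A ⇒ B} → f ∘ ρ⇒ ≈ ρ⇒ ∘ (f ⊗₁ id)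
    α-natural : ∀ {A B C D E F} {f : A ⇒ D} {g : B ⇒ E} {h : C ⇒ F} →
                (f ⊗₁ (g ⊗₁ h)) ∘ α⇒ ≈ α⇒ ∘ ((f ⊗₁ g) ⊗₁ h)
    σ-natural : ∀ {A B C D} {f : A ⇒ C} {g : B ⇒ D} →
                (g ⊗₁ f) ∘ σ ≈ σ ∘ (f ⊗₁ g)

    triangle  : ∀ {A B} → (id {A} ⊗₁ λ⇒ {B}) ∘ α⇒ ≈ ρ⇒ ⊗₁ id
    pentagon  : ∀ {A B C D} →
                (id {A} ⊗₁ α⇒ {B} {C} {D}) ∘ (α⇒ ∘ (α⇒ ⊗₁ id)) ≈ α⇒ ∘ α⇒
    hexagon   : ∀ {A B C} →
                (id {B} ⊗₁ σ {A} {C}) ∘ (α⇒ ∘ (σ ⊗₁ id)) ≈ α⇒ ∘ (σ ∘ α⇒)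

    copy : ∀ A → A ⇒ (A ⊗₀ A)
    del  : ∀ A → A ⇒ I

    copy-assoc : ∀ {A} → α⇒ ∘ ((copy A ⊗₁ id) ∘ copy A) ≈ (id ⊗₁ copy A) ∘ copy A
    counitˡ    : ∀ {A} → λ⇒ ∘ ((del A ⊗₁ id) ∘ copy A) ≈ id
    counitʳ    : ∀ {A} → ρ⇒ ∘ ((id ⊗₁ del A) ∘ copy A) ≈ id
    copy-comm  : ∀ {A} → σ ∘ copy A ≈ copy A

    copy-⊗ : ∀ {A B} →
             copy (A ⊗₀ B) ≈
             (α⇐ ∘ ((id ⊗₁ (α⇒ ∘ ((σ ⊗₁ id) ∘ α⇐))) ∘ α⇒)) ∘ (copy A ⊗₁ copy B)
    del-⊗  : ∀ {A B} → del (A ⊗₀ B) ≈ λ⇒ ∘ (del A ⊗₁ del B)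
    del-I  : del I ≈ id

  -- dom(f) = (id_A ⊗ (del_X ∘ f)) ∘ copy_A  (right unitor made explicit)
  dom : ∀ {A X} → A ⇒ X → A ⇒ A
  dom {A} {X} f = ρ⇒ ∘ ((id ⊗₁ (del X ∘ f)) ∘ copy A)

  Normalized : ∀ {A X} → A ⇒ X → Set e
  Normalized f = f ∘ dom f ≈ f

record TargetContext (o ℓ e r : Level) : Set (suc (o ⊔ ℓ ⊔ e ⊔ r)) where
  field
    gs : GsMonoidal o ℓ e
  open GsMonoidal gs public
  infix 4 _⪰_
  field
    normalized : ∀ {A X} (f : A ⇒ X) → Normalized f
    T C : Obj
    _⪰_ : ∀ {A} → Rel (A ⇒ (T ⊗₀ C)) r
    ⪰-isPreorder : ∀ {A} → IsPreorder (_≈_ {A} {T ⊗₀ C}) (_⪰_ {A})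
    ⪰-dom : ∀ {A} {f g : A ⇒ (T ⊗₀ C)} → f ∘ dom g ≈ g → f ⪰ g
    ⪰-precomp : ∀ {Z A} {f g : A ⇒ (T ⊗₀ C)} (h : Z ⇒ A) → f ⪰ g → (f ∘ h) ⪰ (g ∘ h)

  -- f lax context-reduces to g: ∃ f_C : A ⊗ C → C with
  -- (f ⊗ f_C) ∘ (copy_A ⊗ id_C) ⪰ g ⊗ id_C  (associator made explicit)
  LaxContextReduces : ∀ {A} → Rel (A ⇒ T) (ℓ ⊔ r)
  LaxContextReduces {A} f g =
    Σ ((A ⊗₀ C) ⇒ C) λ fC → ((f ⊗₁ fC) ∘ (α⇒ ∘ (copy A ⊗₁ id))) ⪰ (g ⊗₁ id)

-- For a fixed object A, the functor A ⊗ - is a comonad, with counit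
-- extract = λ ∘ (del_A ⊗ id) and comultiplication duplicate = α ∘ (copy_A ⊗ id);
-- its laws are the counit and coassociativity laws of copy_A, transported
-- along the triangle and pentagon.  The context maps f_C : A ⊗ C → C of lax
-- context-reduction are exactly the co-Kleisli arrows of this comonad:
-- reflexivity is witnessed by the co-Kleisli identity extract, and
-- transitivity by the co-Kleisli composite f_C ∘ extend g_C, using that ⪰ is
-- stable under precomposition with extend g_C.

module Submission where

open import Defs
open import Level using (Level)
open import Relation.Binary using (IsPreorder; IsEquivalence; Setoid)
open import Data.Product using (_,_)
import Relation.Binary.Reasoning.Setoid as SetoidReasoning
import Relation.Binary.Reasoning.Base.Double as PreorderReasoning

module GsMonoidalProperties {o ℓ e : Level} (𝒞 : GsMonoidal o ℓ e) where
  open GsMonoidal 𝒞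

  module ≈ {X Y} = IsEquivalence (≈-equiv {X} {Y})

  hom : Obj → Obj → Setoid ℓ e
  hom X Y = record { Carrier = X ⇒ Y ; _≈_ = _≈_ ; isEquivalence = ≈-equiv }

  module HomReasoning {X Y} = SetoidReasoning (hom X Y)

  infixr 4 refl⟩∘⟨_
  infixl 5 _⟩∘⟨refl

  refl⟩∘⟨_ : ∀ {X Y Z} {h : Y ⇒ Z} {f g : X ⇒ Y} → f ≈ g → h ∘ f ≈ h ∘ g
  refl⟩∘⟨ f≈g = ∘-resp-≈ ≈.refl f≈g

  _⟩∘⟨refl : ∀ {X Y Z} {f g : Y ⇒ Z} {h : X ⇒ Y} → f ≈ g → f ∘ h ≈ g ∘ h
  f≈g ⟩∘⟨refl = ∘-resp-≈ f≈g ≈.refl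

  pullˡ : ∀ {W X Y Z} {a : Y ⇒ Z} {b : X ⇒ Y} {c : X ⇒ Z} {x : W ⇒ X} →
          a ∘ b ≈ c → a ∘ (b ∘ x) ≈ c ∘ x
  pullˡ ab≈c = ≈.trans (≈.sym assoc) (ab≈c ⟩∘⟨refl)

  id⊗-∘ : ∀ {W X Y Z} {g : X ⇒ Y} {h : W ⇒ X} →
          id {Z} ⊗₁ (g ∘ h) ≈ (id ⊗₁ g) ∘ (id ⊗₁ h)
  id⊗-∘ = ≈.trans (⊗-resp-≈ (≈.sym identityˡ) ≈.refl) ⊗-∘

  ⊗id-∘ : ∀ {W X Y Z} {g : X ⇒ Y} {h : W ⇒ X} →
          (g ∘ h) ⊗₁ id {Z} ≈ (g ⊗₁ id) ∘ (h ⊗₁ id)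
  ⊗id-∘ = ≈.trans (⊗-resp-≈ ≈.refl (≈.sym identityˡ)) ⊗-∘

  ⊗-split : ∀ {W X Y Z} {f : W ⇒ X} {g : Y ⇒ Z} → f ⊗₁ g ≈ (f ⊗₁ id) ∘ (id ⊗₁ g)
  ⊗-split = ≈.trans (⊗-resp-≈ (≈.sym identityʳ) (≈.sym identityˡ)) ⊗-∘

  ⊗-commute : ∀ {W X Y Z} {f : W ⇒ X} {g : Y ⇒ Z} →
              (f ⊗₁ id) ∘ (id ⊗₁ g) ≈ (id ⊗₁ g) ∘ (f ⊗₁ id)
  ⊗-commute = ≈.trans (≈.sym ⊗-∘)
    (≈.trans (⊗-resp-≈ (≈.trans identityʳ (≈.sym identityˡ))
                       (≈.trans identityˡ (≈.sym identityʳ))) ⊗-∘)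

  module EnvironmentComonad (A : Obj) where
    open HomReasoning

    duplicate : ∀ {X} → (A ⊗₀ X) ⇒ (A ⊗₀ (A ⊗₀ X))
    duplicate = α⇒ ∘ (copy A ⊗₁ id)

    extract : ∀ {X} → (A ⊗₀ X) ⇒ X
    extract = λ⇒ ∘ (del A ⊗₁ id)

    extend : ∀ {X Y} → (A ⊗₀ X) ⇒ Y → (A ⊗₀ X) ⇒ (A ⊗₀ Y)
    extend g = (id ⊗₁ g) ∘ duplicate

    duplicate-natural : ∀ {X Y} {h : X ⇒ Y} →
                        duplicate ∘ (id ⊗₁ h) ≈ (id ⊗₁ (id ⊗₁ h)) ∘ duplicate
    duplicate-natural {h = h} = begin
      (α⇒ ∘ (c ⊗₁ id)) ∘ (id ⊗₁ h)        ≈⟨ assoc ⟩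
      α⇒ ∘ ((c ⊗₁ id) ∘ (id ⊗₁ h))        ≈⟨ refl⟩∘⟨ ⊗-commute ⟩
      α⇒ ∘ ((id ⊗₁ h) ∘ (c ⊗₁ id))        ≈⟨ refl⟩∘⟨ ⊗-resp-≈ (≈.sym ⊗-id) ≈.refl ⟩∘⟨refl ⟩
      α⇒ ∘ (((id ⊗₁ id) ⊗₁ h) ∘ (c ⊗₁ id)) ≈⟨ pullˡ (≈.sym α-natural) ⟩
      ((id ⊗₁ (id ⊗₁ h)) ∘ α⇒) ∘ (c ⊗₁ id) ≈⟨ assoc ⟩
      (id ⊗₁ (id ⊗₁ h)) ∘ (α⇒ ∘ (c ⊗₁ id)) ∎
      where c = copy A

    duplicate-assoc : ∀ {X} → (id ⊗₁ duplicate) ∘ duplicate ≈ duplicate ∘ duplicate {X}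
    duplicate-assoc = begin
      (id ⊗₁ (α⇒ ∘ (c ⊗₁ id))) ∘ (α⇒ ∘ (c ⊗₁ id))
        ≈⟨ ≈.trans (id⊗-∘ ⟩∘⟨refl) assoc ⟩
      (id ⊗₁ α⇒) ∘ ((id ⊗₁ (c ⊗₁ id)) ∘ (α⇒ ∘ (c ⊗₁ id)))
        ≈⟨ refl⟩∘⟨ ≈.trans (pullˡ α-natural) assoc ⟩
      (id ⊗₁ α⇒) ∘ (α⇒ ∘ (((id ⊗₁ c) ⊗₁ id) ∘ (c ⊗₁ id)))
        ≈⟨ refl⟩∘⟨ refl⟩∘⟨ ≈.sym ⊗id-∘ ⟩
      (id ⊗₁ α⇒) ∘ (α⇒ ∘ (((id ⊗₁ c) ∘ c) ⊗₁ id))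
        ≈⟨ refl⟩∘⟨ refl⟩∘⟨ ≈.trans (⊗-resp-≈ (≈.sym copy-assoc) ≈.refl) ⊗id-∘ ⟩
      (id ⊗₁ α⇒) ∘ (α⇒ ∘ ((α⇒ ⊗₁ id) ∘ (((c ⊗₁ id) ∘ c) ⊗₁ id)))
        ≈⟨ ≈.trans (refl⟩∘⟨ ≈.sym assoc) (≈.sym assoc) ⟩
      ((id ⊗₁ α⇒) ∘ (α⇒ ∘ (α⇒ ⊗₁ id))) ∘ (((c ⊗₁ id) ∘ c) ⊗₁ id)
        ≈⟨ ≈.trans (pentagon ⟩∘⟨refl) assoc ⟩
      α⇒ ∘ (α⇒ ∘ (((c ⊗₁ id) ∘ c) ⊗₁ id))
        ≈⟨ refl⟩∘⟨ refl⟩∘⟨ ⊗id-∘ ⟩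
      α⇒ ∘ (α⇒ ∘ (((c ⊗₁ id) ⊗₁ id) ∘ (c ⊗₁ id)))
        ≈⟨ refl⟩∘⟨ pullˡ (≈.trans (≈.sym α-natural) (⊗-resp-≈ ≈.refl ⊗-id ⟩∘⟨refl)) ⟩
      α⇒ ∘ (((c ⊗₁ id) ∘ α⇒) ∘ (c ⊗₁ id))
        ≈⟨ ≈.trans (refl⟩∘⟨ assoc) (≈.sym assoc) ⟩
      (α⇒ ∘ (c ⊗₁ id)) ∘ (α⇒ ∘ (c ⊗₁ id)) ∎
      where c = copy A

    extend-extract : ∀ {X} → extend (extract {X}) ≈ id
    extend-extract = begin
      (id ⊗₁ (λ⇒ ∘ (del A ⊗₁ id))) ∘ (α⇒ ∘ (copy A ⊗₁ id))
        ≈⟨ ≈.trans (id⊗-∘ ⟩∘⟨refl) assoc ⟩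
      (id ⊗₁ λ⇒) ∘ ((id ⊗₁ (del A ⊗₁ id)) ∘ (α⇒ ∘ (copy A ⊗₁ id)))
        ≈⟨ refl⟩∘⟨ ≈.trans (pullˡ α-natural) assoc ⟩
      (id ⊗₁ λ⇒) ∘ (α⇒ ∘ (((id ⊗₁ del A) ⊗₁ id) ∘ (copy A ⊗₁ id)))
        ≈⟨ pullˡ triangle ⟩
      (ρ⇒ ⊗₁ id) ∘ (((id ⊗₁ del A) ⊗₁ id) ∘ (copy A ⊗₁ id))
        ≈⟨ ≈.sym (≈.trans ⊗id-∘ (refl⟩∘⟨ ⊗id-∘)) ⟩
      (ρ⇒ ∘ ((id ⊗₁ del A) ∘ copy A)) ⊗₁ id
        ≈⟨ ≈.trans (⊗-resp-≈ counitʳ ≈.refl) ⊗-id ⟩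
      id ∎

    extend-∘ : ∀ {X Y Z} {f : (A ⊗₀ Y) ⇒ Z} {g : (A ⊗₀ X) ⇒ Y} →
               extend (f ∘ extend g) ≈ extend f ∘ extend g
    extend-∘ {f = f} {g} = begin
      (id ⊗₁ (f ∘ ((id ⊗₁ g) ∘ duplicate))) ∘ duplicate
        ≈⟨ ≈.trans (≈.trans id⊗-∘ (refl⟩∘⟨ id⊗-∘) ⟩∘⟨refl) (≈.trans assoc (refl⟩∘⟨ assoc)) ⟩
      (id ⊗₁ f) ∘ ((id ⊗₁ (id ⊗₁ g)) ∘ ((id ⊗₁ duplicate) ∘ duplicate))
        ≈⟨ refl⟩∘⟨ refl⟩∘⟨ duplicate-assoc ⟩
      (id ⊗₁ f) ∘ ((id ⊗₁ (id ⊗₁ g)) ∘ (duplicate ∘ duplicate))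
        ≈⟨ refl⟩∘⟨ ≈.trans (pullˡ (≈.sym duplicate-natural)) assoc ⟩
      (id ⊗₁ f) ∘ (duplicate ∘ ((id ⊗₁ g) ∘ duplicate))
        ≈⟨ ≈.sym assoc ⟩
      ((id ⊗₁ f) ∘ duplicate) ∘ ((id ⊗₁ g) ∘ duplicate) ∎

    ⊗-∘-duplicate : ∀ {X Y Z} {f : A ⇒ Y} {g : (A ⊗₀ X) ⇒ Z} →
                    (f ⊗₁ g) ∘ duplicate ≈ (f ⊗₁ id) ∘ extend g
    ⊗-∘-duplicate = ≈.trans (⊗-split ⟩∘⟨refl) assoc

module LaxContextReduction {o ℓ e r : Level} (𝒞 : TargetContext o ℓ e r) {A : TargetContext.Obj 𝒞} where
  open TargetContext 𝒞
  open GsMonoidalProperties gs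
  open EnvironmentComonad A
  open PreorderReasoning (⪰-isPreorder {A ⊗₀ C})

  lax-context-reduces-refl : {f g : A ⇒ T} → f ≈ g → LaxContextReduces f g
  lax-context-reduces-refl {f} {g} f≈g = extract , (begin
    (f ⊗₁ extract) ∘ duplicate    ≈⟨ ⊗-∘-duplicate ⟩
    (f ⊗₁ id) ∘ extend extract    ≈⟨ refl⟩∘⟨ extend-extract ⟩
    (f ⊗₁ id) ∘ id                ≈⟨ identityʳ ⟩
    f ⊗₁ id                       ≈⟨ ⊗-resp-≈ f≈g ≈.refl ⟩
    g ⊗₁ id                       ∎)

  lax-context-reduces-trans : {f g h : A ⇒ T} →
                              LaxContextReduces f g → LaxContextReduces g h → LaxContextReduces f h
  lax-context-reduces-trans {f} {g} {h} (fC , f⪰g) (gC , g⪰h) = fC ∘ extend gC , (begin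
    (f ⊗₁ (fC ∘ extend gC)) ∘ duplicate       ≈⟨ ⊗-∘-duplicate ⟩
    (f ⊗₁ id) ∘ extend (fC ∘ extend gC)       ≈⟨ refl⟩∘⟨ extend-∘ ⟩
    (f ⊗₁ id) ∘ (extend fC ∘ extend gC)       ≈⟨ ≈.sym (≈.trans (⊗-∘-duplicate ⟩∘⟨refl) assoc) ⟩
    ((f ⊗₁ fC) ∘ duplicate) ∘ extend gC       ≲⟨ ⪰-precomp (extend gC) f⪰g ⟩
    (g ⊗₁ id) ∘ extend gC                     ≈⟨ ≈.sym ⊗-∘-duplicate ⟩
    (g ⊗₁ gC) ∘ duplicate                     ≲⟨ g⪰h ⟩
    h ⊗₁ id                                   ∎)

mainTheorem20 : ∀ {o ℓ e r : Level} (𝒞 : TargetContext o ℓ e r) {A : TargetContext.Obj 𝒞} →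
                  IsPreorder (TargetContext._≈_ 𝒞 {A} {TargetContext.T 𝒞}) (TargetContext.LaxContextReduces 𝒞 {A})
mainTheorem20 𝒞 = record
  { isEquivalence = TargetContext.≈-equiv 𝒞
  ; reflexive     = lax-context-reduces-refl
  ; trans         = lax-context-reduces-trans
  }
  where open LaxContextReduction 𝒞
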